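{- Let $J_n$ denote the number of subsets of $V(P_n)$ (including $\emptyset$ and $V(P_n)$) that are $0_2$-invoking, where $P_n$ is the path on $n$ vertices. Then $J_1=2$, $J_2=4$, and $J_n=J_{n-1}+J_{n-2}-2$ for all $n\ge 3$.
   Context: Diffusion on a finite simple graph $G$: a configuration assigns an integer stack size $|v|$ to each vertex; firing a configuration $C$ changes each $v$ simultaneously from $|v|^C$ to $|v|^C + |\{u\in N(v): |u|^C>|v|^C\}| - |\{u\in N(v): |u|^C<|v|^C\}|$. The 0-configuration has all stack sizes $0$. A perturbation of $H\subseteq V(G)$ from the 0-configuration is the step in which every vertex of $H$ sends one chip to each of its neighbours. $H$ is $0_2$-invoking if this perturbation followed by one ordinary firing yields the 0-configuration. -}

module Defs where

open import Data.Bool using (Bool; true; false; if_then_else_; _∧_)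
open import Data.Nat as ℕ using (ℕ; zero; suc)
open import Data.Integer as ℤ using (ℤ; +_; 0ℤ)
open import Data.Fin using (Fin; zero; suc; toℕ)
open import Data.Fin.Properties using (all?)
open import Data.Fin.Subset using (Subset)
open import Data.Vec using (Vec; []; _∷_; lookup)
open import Data.List using (List; []; _∷_; _++_; map; length; filter)
open import Relation.Nullary using (Dec; does)
open import Relation.Binary.PropositionalEquality using (_≡_)

record Graph (n : ℕ) : Set where
  field
    adj   : Fin n → Fin n → Bool
    sym   : ∀ u v → adj u v ≡ adj v u
    irrefl : ∀ v → adj v v ≡ false
open Graph public

count : {n : ℕ} → (Fin n → Bool) → ℕ
count {zero}  p = 0
count {suc n} p = (if p zero then 1 else 0) ℕ.+ count (λ i → p (suc i))

-- configurations: integer stack size at each vertex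
Config : ℕ → Set
Config n = Fin n → ℤ

zeroConfig : {n : ℕ} → Config n
zeroConfig _ = 0ℤ

degree : {n : ℕ} → Graph n → Fin n → ℕ
degree G v = count (λ u → adj G v u)

fire : {n : ℕ} → Graph n → Config n → Config n
fire G C v =
  (C v ℤ.+ + count (λ u → adj G v u ∧ does (C v ℤ.<? C u)))
    ℤ.- + count (λ u → adj G v u ∧ does (C u ℤ.<? C v))

-- perturbation of H from the 0-configuration: every vertex of H sends one chip to each neighbour
perturb : {n : ℕ} → Graph n → Subset n → Config n
perturb G H v =
  + count (λ u → adj G v u ∧ lookup H u)
    ℤ.- (if lookup H v then + degree G v else 0ℤ)

Is02Invoking : {n : ℕ} → Graph n → Subset n → Set
Is02Invoking G H = ∀ v → fire G (perturb G H) v ≡ zeroConfig v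

is02Invoking? : {n : ℕ} → (G : Graph n) → (H : Subset n) → Dec (Is02Invoking G H)
is02Invoking? G H = all? (λ v → fire G (perturb G H) v ℤ.≟ zeroConfig v)

pathAdj : {n : ℕ} → Fin n → Fin n → Bool
pathAdj i j = does (toℕ j ℕ.≟ suc (toℕ i)) Data.Bool.∨ does (toℕ i ℕ.≟ suc (toℕ j))
  where import Data.Bool

allSubsets : (n : ℕ) → List (Subset n)
allSubsets zero    = [] ∷ []
allSubsets (suc n) = map (true ∷_) (allSubsets n) ++ map (false ∷_) (allSubsets n)

private
  open import Relation.Binary.PropositionalEquality using (refl)

  pathAdj-sym : {n : ℕ} (i j : Fin n) → pathAdj i j ≡ pathAdj j i
  pathAdj-sym i j = Data.Bool.Properties.∨-comm (does (toℕ j ℕ.≟ suc (toℕ i))) (does (toℕ i ℕ.≟ suc (toℕ j)))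
    where import Data.Bool.Properties

  ≡ᵇ-suc : (m : ℕ) → (m ℕ.≡ᵇ suc m) ≡ false
  ≡ᵇ-suc zero    = refl
  ≡ᵇ-suc (suc m) = ≡ᵇ-suc m

  pathAdj-irrefl : {n : ℕ} (i : Fin n) → pathAdj i i ≡ false
  pathAdj-irrefl i rewrite ≡ᵇ-suc (toℕ i) = refl

P : (n : ℕ) → Graph n
P n = record { adj = pathAdj ; sym = pathAdj-sym ; irrefl = pathAdj-irrefl }

J : ℕ → ℕ
J n = length (filter (is02Invoking? (P n)) (allSubsets n))

module Submission where

-- After H perturbs the path and the configuration fires once, the stack at v depends only on
-- which of v-2, …, v+2 lie in H.  So H is 0₂-invoking iff every window of five consecutive
-- letters of H (padded with absent vertices) passes a fixed local test.  The number of
-- accepted continuations of a word then depends only on its last four letters and satisfies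
-- a transfer recursion whose solutions are Fibonacci numbers: J (1 + n) = 2 + 2 F n.

open import Defs
open import Data.Bool using (Bool; true; false; if_then_else_; _∧_; T)
open import Data.Bool.Properties using (∧-identityʳ; T-∧)
open import Data.Nat using (ℕ; zero; suc; _+_; _*_)
open import Data.Nat.Properties using (+-identityʳ; +-comm)
open import Data.Nat.Tactic.RingSolver using (solve-∀)
open import Data.Integer as ℤ using (ℤ; 0ℤ)
open import Data.Fin using (Fin; zero; suc; inject₁)
open import Data.Maybe as Maybe using (Maybe; nothing; just; maybe′; _>>=_)
open import Data.Maybe.Properties using (map-∘)
open import Data.Vec using (Vec; []; _∷_; lookup)
open import Data.List as List using (_++_; map; length; filter)
open import Data.List.Properties using (length-++; filter-++; filter-≐; filter-none)
open import Data.List.Relation.Unary.All using (universal)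
open import Data.Product using (_×_; _,_; proj₁; proj₂)
open import Function using (_∘_; _⇔_; mk⇔; Equivalence)
open import Relation.Nullary.Decidable using (does; T?; ⌊_⌋; toWitness; fromWitness)
open import Relation.Binary.PropositionalEquality
  using (_≡_; refl; cong; cong₂; trans; subst; module ≡-Reasoning)
  renaming (sym to ≡-sym)

count-false : ∀ n → count {n} (λ _ → false) ≡ 0
count-false zero    = refl
count-false (suc n) = count-false n

count-cong : ∀ {n} {p q : Fin n → Bool} → (∀ i → p i ≡ q i) → count p ≡ count q
count-cong {zero}  eq = refl
count-cong {suc n} eq rewrite eq zero = cong (_ +_) (count-cong (eq ∘ suc))

left : ∀ {n} → Fin n → Maybe (Fin n)
left zero    = nothing
left (suc v) = just (inject₁ v)

-- The suc clause comes first so that right (suc v) computes for a neutral n.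
right : ∀ {n} → Fin n → Maybe (Fin n)
right             (suc v) = Maybe.map suc (right v)
right {suc zero}    zero  = nothing
right {suc (suc _)} zero  = just (suc zero)

right-inject₁ : ∀ {n} (v : Fin n) → right (inject₁ v) ≡ just (suc v)
right-inject₁ {suc _} zero    = refl
right-inject₁         (suc v) rewrite right-inject₁ v = refl

right-left : ∀ {n} {u v : Fin n} → left v ≡ just u → right u ≡ just v
right-left {v = suc v} refl = right-inject₁ v

left-right : ∀ {n} {u v : Fin n} → right v ≡ just u → left u ≡ just v
left-right {suc (suc _)} {v = zero} refl = refl
left-right {v = suc v} eq with right v in eqᵥ | eq
... | just zero    | refl with () ← left-right {v = v} eqᵥ
... | just (suc _) | refl with refl ← left-right {v = v} eqᵥ = refl

trueCount : Maybe Bool → ℕ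
trueCount nothing  = 0
trueCount (just b) = if b then 1 else 0

present : ∀ {A : Set} → Maybe A → ℕ
present = trueCount ∘ Maybe.map (λ _ → true)

trueCount-map-∘ : ∀ {A B : Set} (g : B → Bool) (f : A → B) x →
                  trueCount (Maybe.map (g ∘ f) x) ≡ trueCount (Maybe.map g (Maybe.map f x))
trueCount-map-∘ g f x = cong trueCount (map-∘ x)

count-pathAdj : ∀ {n} (v : Fin n) (g : Fin n → Bool) →
                count (λ u → pathAdj v u ∧ g u)
                  ≡ trueCount (Maybe.map g (left v)) + trueCount (Maybe.map g (right v))
count-pathAdj {suc zero}    zero          g = refl
count-pathAdj {suc (suc n)} zero          g rewrite count-false n = +-identityʳ _
count-pathAdj {suc n}       (suc zero)    g
  rewrite count-pathAdj zero (g ∘ suc) | trueCount-map-∘ g suc (right {n} zero) = refl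
count-pathAdj {suc n}       (suc (suc v)) g
  rewrite count-pathAdj (suc v) (g ∘ suc) | trueCount-map-∘ g suc (right (suc v)) = refl

degree-P : ∀ {n} (v : Fin n) → degree (P n) v ≡ present (left v) + present (right v)
degree-P v =
  trans (count-cong (λ u → ≡-sym (∧-identityʳ (pathAdj v u)))) (count-pathAdj v (λ _ → true))

perturbAt : Maybe Bool → Bool → Maybe Bool → ℤ
perturbAt l h r =
  ℤ.+ (trueCount l + trueCount r) ℤ.- (if h then ℤ.+ (present l + present r) else 0ℤ)

perturb-P : ∀ {n} (H : Vec Bool n) v →
            perturb (P n) H v
              ≡ perturbAt (Maybe.map (lookup H) (left v)) (lookup H v) (Maybe.map (lookup H) (right v))
perturb-P H v
  rewrite count-pathAdj v (lookup H) | degree-P v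
        | trueCount-map-∘ (λ _ → true) (lookup H) (left v)
        | trueCount-map-∘ (λ _ → true) (lookup H) (right v) = refl

fireAt : Maybe ℤ → ℤ → Maybe ℤ → ℤ
fireAt l c r = (c ℤ.+ ℤ.+ (richer l + richer r)) ℤ.- ℤ.+ (poorer l + poorer r)
  where
  richer poorer : Maybe ℤ → ℕ
  richer = trueCount ∘ Maybe.map (λ d → does (c ℤ.<? d))
  poorer = trueCount ∘ Maybe.map (λ d → does (d ℤ.<? c))

fire-P : ∀ {n} (C : Config n) v →
         fire (P n) C v ≡ fireAt (Maybe.map C (left v)) (C v) (Maybe.map C (right v))
fire-P C v
  rewrite count-pathAdj v (λ u → does (C v ℤ.<? C u)) | count-pathAdj v (λ u → does (C u ℤ.<? C v))
        | trueCount-map-∘ (λ d → does (C v ℤ.<? d)) C (left v)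
        | trueCount-map-∘ (λ d → does (C v ℤ.<? d)) C (right v)
        | trueCount-map-∘ (λ d → does (d ℤ.<? C v)) C (left v)
        | trueCount-map-∘ (λ d → does (d ℤ.<? C v)) C (right v) = refl

-- The stack of a vertex after perturbation and one firing, from the membership in H of the
-- vertices at distance ≤ 2 on either side; nothing marks a missing vertex.
invokedAt : Maybe Bool → Maybe Bool → Bool → Maybe Bool → Maybe Bool → ℤ
invokedAt l₂ l₁ h r₁ r₂ =
  fireAt (Maybe.map (λ b → perturbAt l₂ b (just h)) l₁)
         (perturbAt l₁ h r₁)
         (Maybe.map (λ b → perturbAt (just h) b r₂) r₁)

windowOk : Maybe Bool → Maybe Bool → Bool → Maybe Bool → Maybe Bool → Bool
windowOk l₂ l₁ h r₁ r₂ = ⌊ invokedAt l₂ l₁ h r₁ r₂ ℤ.≟ 0ℤ ⌋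

readOr : ∀ {n} → Maybe Bool → Vec Bool n → Maybe (Fin n) → Maybe Bool
readOr p H = maybe′ (just ∘ lookup H) p

-- The window of H around v, where p₁ and p₂ stand for the entries one and two places
-- left of vertex 0.
onWindow : ∀ {n} {A : Set} → Maybe Bool → Maybe Bool → Vec Bool n → Fin n →
           (Maybe Bool → Maybe Bool → Bool → Maybe Bool → Maybe Bool → A) → A
onWindow p₂ p₁ H v f =
  f (maybe′ (readOr p₁ H ∘ left) p₂ (left v)) (readOr p₁ H (left v)) (lookup H v)
    (readOr nothing H (right v)) (readOr nothing H (right v >>= right))

perturb-P-left : ∀ {n} (H : Vec Bool n) v →
                 Maybe.map (perturb (P n) H) (left v)
                   ≡ Maybe.map (λ b → perturbAt (maybe′ (readOr nothing H ∘ left) nothing (left v))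
                                                b (just (lookup H v)))
                               (readOr nothing H (left v))
perturb-P-left H v with left v in eq
... | nothing = refl
... | just u rewrite perturb-P H u | right-left eq = refl

perturb-P-right : ∀ {n} (H : Vec Bool n) v →
                  Maybe.map (perturb (P n) H) (right v)
                    ≡ Maybe.map (λ b → perturbAt (just (lookup H v)) b
                                                 (readOr nothing H (right v >>= right)))
                                (readOr nothing H (right v))
perturb-P-right H v with right v in eq
... | nothing = refl
... | just u rewrite perturb-P H u | left-right eq = refl

fire-perturb-P : ∀ {n} (H : Vec Bool n) v →
                 fire (P n) (perturb (P n) H) v ≡ onWindow nothing nothing H v invokedAt
fire-perturb-P {n} H v
  rewrite fire-P (perturb (P n) H) v | perturb-P-left H v | perturb-P-right H v | perturb-P H v = refl

windowsOk : ∀ {n} → Maybe Bool → Maybe Bool → Vec Bool n → Bool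
windowsOk p₂ p₁ []      = true
windowsOk p₂ p₁ (h ∷ H) = onWindow p₂ p₁ (h ∷ H) zero windowOk ∧ windowsOk p₁ (just h) H

readOr-left-suc : ∀ {n} p (h : Bool) (H : Vec Bool n) v →
                  readOr p (h ∷ H) (left (suc v)) ≡ readOr (just h) H (left v)
readOr-left-suc p h H zero    = refl
readOr-left-suc p h H (suc v) = refl

readOr-left²-suc : ∀ {n} p₂ p₁ (h : Bool) (H : Vec Bool n) v →
                   maybe′ (readOr p₁ (h ∷ H) ∘ left) p₂ (left (suc v))
                     ≡ maybe′ (readOr (just h) H ∘ left) p₁ (left v)
readOr-left²-suc p₂ p₁ h H zero          = refl
readOr-left²-suc p₂ p₁ h H (suc zero)    = refl
readOr-left²-suc p₂ p₁ h H (suc (suc v)) = refl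

readOr-map-suc : ∀ {n} (h : Bool) (H : Vec Bool n) x →
                 readOr nothing (h ∷ H) (Maybe.map suc x) ≡ readOr nothing H x
readOr-map-suc h H nothing  = refl
readOr-map-suc h H (just _) = refl

map-suc->>=-right : ∀ {n} (x : Maybe (Fin n)) →
                    (Maybe.map suc x >>= right) ≡ Maybe.map suc (x >>= right)
map-suc->>=-right nothing  = refl
map-suc->>=-right (just _) = refl

windowOk-cong : ∀ {l₂ l₂′ l₁ l₁′ h r₁ r₁′ r₂ r₂′} →
                l₂ ≡ l₂′ → l₁ ≡ l₁′ → r₁ ≡ r₁′ → r₂ ≡ r₂′ →
                windowOk l₂ l₁ h r₁ r₂ ≡ windowOk l₂′ l₁′ h r₁′ r₂′
windowOk-cong refl refl refl refl = refl

onWindow-suc : ∀ {n} p₂ p₁ (h : Bool) (H : Vec Bool n) v →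
               onWindow p₂ p₁ (h ∷ H) (suc v) windowOk ≡ onWindow p₁ (just h) H v windowOk
onWindow-suc p₂ p₁ h H v =
  windowOk-cong {h = lookup H v} (readOr-left²-suc p₂ p₁ h H v) (readOr-left-suc p₁ h H v)
                (readOr-map-suc h H (right v))
                (trans (cong (readOr nothing (h ∷ H)) (map-suc->>=-right (right v)))
                       (readOr-map-suc h H (right v >>= right)))

windowsOk⇔ : ∀ {n} p₂ p₁ (H : Vec Bool n) →
             T (windowsOk p₂ p₁ H) ⇔ (∀ v → T (onWindow p₂ p₁ H v windowOk))
windowsOk⇔ p₂ p₁ []      = mk⇔ (λ _ ()) _
windowsOk⇔ p₂ p₁ (h ∷ H) = mk⇔ to from
  where
  rest = windowsOk⇔ p₁ (just h) H

  to : T (windowsOk p₂ p₁ (h ∷ H)) → ∀ v → T (onWindow p₂ p₁ (h ∷ H) v windowOk)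
  to t zero    = proj₁ (Equivalence.to T-∧ t)
  to t (suc v) =
    subst T (≡-sym (onWindow-suc p₂ p₁ h H v)) (Equivalence.to rest (proj₂ (Equivalence.to T-∧ t)) v)

  from : (∀ v → T (onWindow p₂ p₁ (h ∷ H) v windowOk)) → T (windowsOk p₂ p₁ (h ∷ H))
  from all = Equivalence.from T-∧
    (all zero , Equivalence.from rest (λ v → subst T (onWindow-suc p₂ p₁ h H v) (all (suc v))))

is02Invoking⇔windowsOk : ∀ {n} (H : Vec Bool n) → Is02Invoking (P n) H ⇔ T (windowsOk nothing nothing H)
is02Invoking⇔windowsOk {n} H = mk⇔
  (λ inv → Equivalence.from (windowsOk⇔ nothing nothing H)
             (λ v → fromWitness (trans (≡-sym (fire-perturb-P H v)) (inv v))))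
  (λ t v → trans (fire-perturb-P H v) (toWitness (Equivalence.to (windowsOk⇔ nothing nothing H) t v)))

countSubsets : ∀ n → (Vec Bool n → Bool) → ℕ
countSubsets n f = length (filter (T? ∘ f) (allSubsets n))

J≡countSubsets : ∀ n → J n ≡ countSubsets n (windowsOk nothing nothing)
J≡countSubsets n = cong length
  (filter-≐ (is02Invoking? (P n)) (T? ∘ windowsOk nothing nothing)
            ( (λ {H} → Equivalence.to (is02Invoking⇔windowsOk H))
            , (λ {H} → Equivalence.from (is02Invoking⇔windowsOk H)))
            (allSubsets n))

length-filter-map : ∀ {A B : Set} (f : B → Bool) (g : A → B) xs →
                    length (filter (T? ∘ f) (map g xs)) ≡ length (filter (T? ∘ f ∘ g) xs)
length-filter-map f g List.[]       = refl
length-filter-map f g (x List.∷ xs) with f (g x)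
... | true  = cong suc (length-filter-map f g xs)
... | false = length-filter-map f g xs

countSubsets-suc : ∀ n (f : Vec Bool (suc n) → Bool) →
                   countSubsets (suc n) f ≡ countSubsets n (f ∘ (true ∷_)) + countSubsets n (f ∘ (false ∷_))
countSubsets-suc n f = begin
  length (filter (T? ∘ f) (map (true ∷_) Sₙ ++ map (false ∷_) Sₙ))
    ≡⟨ cong length (filter-++ (T? ∘ f) (map (true ∷_) Sₙ) (map (false ∷_) Sₙ)) ⟩
  length (filter (T? ∘ f) (map (true ∷_) Sₙ) ++ filter (T? ∘ f) (map (false ∷_) Sₙ))
    ≡⟨ length-++ (filter (T? ∘ f) (map (true ∷_) Sₙ)) ⟩
  length (filter (T? ∘ f) (map (true ∷_) Sₙ)) + length (filter (T? ∘ f) (map (false ∷_) Sₙ))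
    ≡⟨ cong₂ _+_ (length-filter-map f (true ∷_) Sₙ) (length-filter-map f (false ∷_) Sₙ) ⟩
  countSubsets n (f ∘ (true ∷_)) + countSubsets n (f ∘ (false ∷_)) ∎
  where
  open ≡-Reasoning
  Sₙ = allSubsets n

countSubsets-∧ : ∀ n k (f : Vec Bool n → Bool) →
                 countSubsets n (λ H → k ∧ f H) ≡ (if k then countSubsets n f else 0)
countSubsets-∧ n true  f = refl
countSubsets-∧ n false f =
  cong length (filter-none (λ _ → T? false) (universal (λ _ ()) (allSubsets n)))

completions : Maybe Bool → Maybe Bool → Bool → Bool → ℕ → ℕ
completions p₂ p₁ b c n = countSubsets n (λ H → windowsOk p₂ p₁ (b ∷ c ∷ H))

completions-suc : ∀ p₂ p₁ b c n {F : Bool → ℕ} → (∀ d → completions p₁ (just b) c d n ≡ F d) →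
                  completions p₂ p₁ b c (suc n)
                    ≡ (if windowOk p₂ p₁ b (just c) (just true)  then F true  else 0)
                    + (if windowOk p₂ p₁ b (just c) (just false) then F false else 0)
completions-suc p₂ p₁ b c n {F} eq = trans (countSubsets-suc n _) (cong₂ _+_ (step true) (step false))
  where
  step : ∀ d → countSubsets n (λ H → windowsOk p₂ p₁ (b ∷ c ∷ d ∷ H))
               ≡ (if windowOk p₂ p₁ b (just c) (just d) then F d else 0)
  step d = trans (countSubsets-∧ n (windowOk p₂ p₁ b (just c) (just d)) _)
                 (cong (λ m → if windowOk p₂ p₁ b (just c) (just d) then m else 0) (eq d))

fib : ℕ → ℕ
fib zero          = 0
fib (suc zero)    = 1
fib (suc (suc n)) = fib (suc n) + fib n

-- An accepted word is constant, or all its runs have length ≤ 2 and the first and last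
-- have length 1; counting such continuations gives the tables below.
closedForm₂ : Bool → Bool → Bool → Bool → ℕ → ℕ
closedForm₂ false false false false n = 1
closedForm₂ false false false true  n = 0
closedForm₂ false false true  false n = fib (suc n)
closedForm₂ false false true  true  n = fib n
closedForm₂ false true  false false n = fib n
closedForm₂ false true  false true  n = fib (suc n)
closedForm₂ false true  true  false n = fib (suc n)
closedForm₂ false true  true  true  n = 0
closedForm₂ true  false false false n = 0
closedForm₂ true  false false true  n = fib (suc n)
closedForm₂ true  false true  false n = fib (suc n)
closedForm₂ true  false true  true  n = fib n
closedForm₂ true  true  false false n = fib n
closedForm₂ true  true  false true  n = fib (suc n)
closedForm₂ true  true  true  false n = 0
closedForm₂ true  true  true  true  n = 1

closedForm₂-zero : ∀ a b c d → completions (just a) (just b) c d 0 ≡ closedForm₂ a b c d 0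
closedForm₂-zero false false false false = refl
closedForm₂-zero false false false true  = refl
closedForm₂-zero false false true  false = refl
closedForm₂-zero false false true  true  = refl
closedForm₂-zero false true  false false = refl
closedForm₂-zero false true  false true  = refl
closedForm₂-zero false true  true  false = refl
closedForm₂-zero false true  true  true  = refl
closedForm₂-zero true  false false false = refl
closedForm₂-zero true  false false true  = refl
closedForm₂-zero true  false true  false = refl
closedForm₂-zero true  false true  true  = refl
closedForm₂-zero true  true  false false = refl
closedForm₂-zero true  true  false true  = refl
closedForm₂-zero true  true  true  false = refl
closedForm₂-zero true  true  true  true  = refl

closedForm₂-suc : ∀ a b c d n →
                  (if windowOk (just a) (just b) c (just d) (just true)  then closedForm₂ b c d true  n else 0)
                  + (if windowOk (just a) (just b) c (just d) (just false) then closedForm₂ b c d false n else 0)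
                  ≡ closedForm₂ a b c d (suc n)
closedForm₂-suc false false false false n = refl
closedForm₂-suc false false false true  n = refl
closedForm₂-suc false false true  false n = refl
closedForm₂-suc false false true  true  n = refl
closedForm₂-suc false true  false false n = +-identityʳ _
closedForm₂-suc false true  false true  n = +-comm (fib n) (fib (suc n))
closedForm₂-suc false true  true  false n = refl
closedForm₂-suc false true  true  true  n = refl
closedForm₂-suc true  false false false n = refl
closedForm₂-suc true  false false true  n = +-comm (fib n) (fib (suc n))
closedForm₂-suc true  false true  false n = refl
closedForm₂-suc true  false true  true  n = refl
closedForm₂-suc true  true  false false n = +-identityʳ _
closedForm₂-suc true  true  false true  n = +-comm (fib n) (fib (suc n))
closedForm₂-suc true  true  true  false n = refl
closedForm₂-suc true  true  true  true  n = refl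

completions≡closedForm₂ : ∀ a b c d n → completions (just a) (just b) c d n ≡ closedForm₂ a b c d n
completions≡closedForm₂ a b c d zero    = closedForm₂-zero a b c d
completions≡closedForm₂ a b c d (suc n) =
  trans (completions-suc (just a) (just b) c d n (λ e → completions≡closedForm₂ b c d e n))
        (closedForm₂-suc a b c d n)

closedForm₁ : Bool → Bool → Bool → ℕ → ℕ
closedForm₁ false false false n = 1
closedForm₁ false false true  n = 0
closedForm₁ false true  false n = fib (suc n)
closedForm₁ false true  true  n = fib n
closedForm₁ true  false false n = fib n
closedForm₁ true  false true  n = fib (suc n)
closedForm₁ true  true  false n = 0
closedForm₁ true  true  true  n = 1

closedForm₁-zero : ∀ b c d → completions nothing (just b) c d 0 ≡ closedForm₁ b c d 0
closedForm₁-zero false false false = refl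
closedForm₁-zero false false true  = refl
closedForm₁-zero false true  false = refl
closedForm₁-zero false true  true  = refl
closedForm₁-zero true  false false = refl
closedForm₁-zero true  false true  = refl
closedForm₁-zero true  true  false = refl
closedForm₁-zero true  true  true  = refl

closedForm₁-suc : ∀ b c d n →
                  (if windowOk nothing (just b) c (just d) (just true)  then closedForm₂ b c d true  n else 0)
                  + (if windowOk nothing (just b) c (just d) (just false) then closedForm₂ b c d false n else 0)
                  ≡ closedForm₁ b c d (suc n)
closedForm₁-suc false false false n = refl
closedForm₁-suc false false true  n = refl
closedForm₁-suc false true  false n = refl
closedForm₁-suc false true  true  n = refl
closedForm₁-suc true  false false n = +-identityʳ _
closedForm₁-suc true  false true  n = +-comm (fib n) (fib (suc n))
closedForm₁-suc true  true  false n = refl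
closedForm₁-suc true  true  true  n = refl

completions≡closedForm₁ : ∀ b c d n → completions nothing (just b) c d n ≡ closedForm₁ b c d n
completions≡closedForm₁ b c d zero    = closedForm₁-zero b c d
completions≡closedForm₁ b c d (suc n) =
  trans (completions-suc nothing (just b) c d n (λ e → completions≡closedForm₂ b c d e n))
        (closedForm₁-suc b c d n)

closedForm₀ : Bool → Bool → ℕ → ℕ
closedForm₀ false false n = 1
closedForm₀ false true  n = fib (suc n)
closedForm₀ true  false n = fib (suc n)
closedForm₀ true  true  n = 1

closedForm₀-zero : ∀ b c → completions nothing nothing b c 0 ≡ closedForm₀ b c 0
closedForm₀-zero false false = refl
closedForm₀-zero false true  = refl
closedForm₀-zero true  false = refl
closedForm₀-zero true  true  = refl

closedForm₀-suc : ∀ b c n →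
                  (if windowOk nothing nothing b (just c) (just true)  then closedForm₁ b c true  n else 0)
                  + (if windowOk nothing nothing b (just c) (just false) then closedForm₁ b c false n else 0)
                  ≡ closedForm₀ b c (suc n)
closedForm₀-suc false false n = +-identityʳ _
closedForm₀-suc false true  n = +-comm (fib n) (fib (suc n))
closedForm₀-suc true  false n = refl
closedForm₀-suc true  true  n = refl

completions≡closedForm₀ : ∀ b c n → completions nothing nothing b c n ≡ closedForm₀ b c n
completions≡closedForm₀ b c zero    = closedForm₀-zero b c
completions≡closedForm₀ b c (suc n) =
  trans (completions-suc nothing nothing b c n (λ d → completions≡closedForm₁ b c d n))
        (closedForm₀-suc b c n)

J-suc : ∀ n → J (suc n) ≡ 2 + 2 * fib n
J-suc zero    = refl
J-suc (suc n) = begin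
  J (2 + n)
    ≡⟨ J≡countSubsets (2 + n) ⟩
  countSubsets (2 + n) (windowsOk nothing nothing)
    ≡⟨ countSubsets-suc (suc n) _ ⟩
  countSubsets (suc n) (windowsOk nothing nothing ∘ (true ∷_))
    + countSubsets (suc n) (windowsOk nothing nothing ∘ (false ∷_))
    ≡⟨ cong₂ _+_ (countSubsets-suc n _) (countSubsets-suc n _) ⟩
  (completions nothing nothing true true n + completions nothing nothing true false n)
    + (completions nothing nothing false true n + completions nothing nothing false false n)
    ≡⟨ cong₂ _+_ (cong₂ _+_ (completions≡closedForm₀ true true n) (completions≡closedForm₀ true false n))
                 (cong₂ _+_ (completions≡closedForm₀ false true n) (completions≡closedForm₀ false false n)) ⟩
  (1 + fib (suc n)) + (fib (suc n) + 1)
    ≡⟨ arith (fib (suc n)) ⟩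
  2 + 2 * fib (suc n) ∎
  where
  open ≡-Reasoning
  arith : ∀ x → (1 + x) + (x + 1) ≡ 2 + 2 * x
  arith = solve-∀

mainTheorem9 : (J 1 ≡ 2) × (J 2 ≡ 4)
    × (∀ (n : ℕ) → J (suc (suc (suc n))) + 2 ≡ J (suc (suc n)) + J (suc n))
mainTheorem9 = J-suc 0 , J-suc 1 , recurrence
  where
  recurrence : ∀ n → J (3 + n) + 2 ≡ J (2 + n) + J (1 + n)
  recurrence n rewrite J-suc (2 + n) | J-suc (1 + n) | J-suc n = arith (fib (suc n)) (fib n)
    where
    arith : ∀ x y → (2 + 2 * (x + y)) + 2 ≡ (2 + 2 * x) + (2 + 2 * y)
    arith = solve-∀
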